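{- Let $G$ be a graph with no $K_{1,1,3}$ minor, no $K_1 \cup K_4$ minor and no $K_1 \cup K_{2,3}$ minor, and let $S$ be a spanning subgraph of $G$ that is a subdivision of $K_{2,3}$ with terminal paths $P_1,P_2,P_3$, where $P_2$ is a middle path among $\{P_1,P_2,P_3\}$. Then each of $G[P_1 \cup P_2]$ and $G[P_2 \cup P_3]$ is a subgraph of a fan graph whose handle is one of the outer inner vertices of $P_2$.
   Context: A subdivision of a graph is obtained by repeatedly replacing an edge by a path of length 2 through a new vertex. For a subdivision $S$ of $K_{2,3}$, the terminal vertices are the two vertices $u,v$ of degree $3$ in $S$ and the terminal paths are the three $uv$-paths of $S$; $S$ is spanning if it contains all vertices of $G$. $G[H]$ is the subgraph of $G$ induced by the vertices of $H$. An inner vertex of a $uv$-path is a vertex other than $u,v$; the outer inner vertices of a $uv$-path $P$ are the inner vertices of $P$ that are adjacent on $P$ to $u$ or to $v$. Given a set $\mathcal{P}$ of paths in $G$, $P\in\mathcal{P}$ is a middle path if for every other $P'\in\mathcal{P}$ some edge of $G$ joins an inner vertex of $P$ to an inner vertex of $P'$. A fan graph is obtained from a path $Q$ and a vertex $h\notin Q$ by adding an edge from $h$ to every vertex of $Q$; $h$ is the handle of the fan. $\cup$ in $K_1\cup K_4$, $K_1\cup K_{2,3}$ denotes disjoint union. -}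

module Defs where

open import Data.Nat using (ℕ)
open import Data.Fin using (Fin)
open import Data.Fin using (#_)
open import Data.Maybe using (Maybe; just)
open import Data.Product using (Σ; ∃; ∃-syntax; _×_; _,_)
open import Data.Sum using (_⊎_)
open import Data.List using (List; []; _∷_; _++_)
open import Data.List.Membership.Propositional using (_∈_; _∉_)
open import Data.List.Relation.Unary.Linked using (Linked)
open import Data.List.Relation.Unary.Unique.Propositional using (Unique)
open import Relation.Binary.PropositionalEquality using (_≡_; _≢_)
open import Relation.Nullary using (¬_)

record Graph (n : ℕ) : Set₁ where
  field
    Adj    : Fin n → Fin n → Set
    sym    : ∀ {x y} → Adj x y → Adj y x
    irrefl : ∀ {x} → ¬ Adj x x
open Graph public

data WalkIn {n : ℕ} (G : Graph n) (P : Fin n → Set) : Fin n → Fin n → Set where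
  here : ∀ {a} → P a → WalkIn G P a a
  step : ∀ {a b c} → P a → Adj G a b → WalkIn G P b c → WalkIn G P a c

-- A minor model of the graph H = (Fin m, HAdj) in G: β assigns each vertex of
-- G to at most one branch set (so branch sets are disjoint); branch sets are
-- nonempty and connected in G, and each edge of H is realised by an edge of G
-- between the corresponding branch sets.
record MinorModel {n : ℕ} (m : ℕ) (HAdj : Fin m → Fin m → Set) (G : Graph n) : Set where
  field
    β         : Fin n → Maybe (Fin m)
    nonempty  : ∀ x → ∃[ a ] (β a ≡ just x)
    connected : ∀ x a b → β a ≡ just x → β b ≡ just x
                → WalkIn G (λ w → β w ≡ just x) a b
    edges     : ∀ x y → HAdj x y
                → ∃[ a ] ∃[ b ] (β a ≡ just x × β b ≡ just y × Adj G a b)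

HasMinor : {n : ℕ} → (m : ℕ) → (Fin m → Fin m → Set) → Graph n → Set
HasMinor m HAdj G = MinorModel m HAdj G

EdgeAdj : {m : ℕ} → List (Fin m × Fin m) → Fin m → Fin m → Set
EdgeAdj es x y = ((x , y) ∈ es) ⊎ ((y , x) ∈ es)

-- K_{1,1,3}: parts {0},{1},{2,3,4}.
K113 : Fin 5 → Fin 5 → Set
K113 = EdgeAdj ((# 0 , # 1) ∷ (# 0 , # 2) ∷ (# 0 , # 3) ∷ (# 0 , # 4) ∷ (# 1 , # 2) ∷ (# 1 , # 3) ∷ (# 1 , # 4) ∷ [])

-- K_1 ∪ K_4: 0 isolated, {1,2,3,4} complete.
K1∪K4 : Fin 5 → Fin 5 → Set
K1∪K4 = EdgeAdj ((# 1 , # 2) ∷ (# 1 , # 3) ∷ (# 1 , # 4) ∷ (# 2 , # 3) ∷ (# 2 , # 4) ∷ (# 3 , # 4) ∷ [])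

-- K_1 ∪ K_{2,3}: 0 isolated, parts {1,2} and {3,4,5}.
K1∪K23 : Fin 6 → Fin 6 → Set
K1∪K23 = EdgeAdj ((# 1 , # 3) ∷ (# 1 , # 4) ∷ (# 1 , # 5) ∷ (# 2 , # 3) ∷ (# 2 , # 4) ∷ (# 2 , # 5) ∷ [])

pathVerts : {n : ℕ} → Fin n → Fin n → List (Fin n) → List (Fin n)
pathVerts u v I = u ∷ I ++ v ∷ []

-- S, given by terminals u,v and the inner vertex sequences I₁,I₂,I₃ of the
-- three terminal paths, is a spanning subgraph of G that is a subdivision of
-- K_{2,3}: all listed vertices distinct, every path has at least one inner
-- vertex, consecutive path vertices are adjacent in G, and every vertex of G
-- lies on S.
record SpanningK23Subdivision {n : ℕ} (G : Graph n) (u v : Fin n)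
                              (I₁ I₂ I₃ : List (Fin n)) : Set where
  field
    distinct  : Unique (u ∷ v ∷ I₁ ++ I₂ ++ I₃)
    nonempty₁ : I₁ ≢ []
    nonempty₂ : I₂ ≢ []
    nonempty₃ : I₃ ≢ []
    path₁     : Linked (Adj G) (pathVerts u v I₁)
    path₂     : Linked (Adj G) (pathVerts u v I₂)
    path₃     : Linked (Adj G) (pathVerts u v I₃)
    spanning  : ∀ w → w ∈ (u ∷ v ∷ I₁ ++ I₂ ++ I₃)

InnerLinked : {n : ℕ} → Graph n → List (Fin n) → List (Fin n) → Set
InnerLinked G I J = ∃[ a ] ∃[ b ] (a ∈ I × b ∈ J × Adj G a b)

MiddlePath : {n : ℕ} → Graph n → List (Fin n) → List (Fin n) → List (Fin n) → Set
MiddlePath G I₁ I₂ I₃ = InnerLinked G I₂ I₁ × InnerLinked G I₂ I₃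

-- h is an outer inner vertex of the uv-path with inner vertices I
-- (adjacent on the path to u, i.e. first, or to v, i.e. last).
OuterInner : {n : ℕ} → Fin n → List (Fin n) → Set
OuterInner h I = (∃[ r ] (I ≡ h ∷ r)) ⊎ (∃[ r ] (I ≡ r ++ h ∷ []))

Consecutive : {n : ℕ} → List (Fin n) → Fin n → Fin n → Set
Consecutive Q a b = ∃[ l ] ∃[ r ] ((Q ≡ l ++ a ∷ b ∷ r) ⊎ (Q ≡ l ++ b ∷ a ∷ r))

-- The induced subgraph G[X] (X given as a vertex list) is a subgraph of a fan
-- graph with handle h: h ∈ X, and there is a path Q (a sequence of distinct
-- vertices, not containing h, covering X ∖ {h}) such that every edge of G[X]
-- not incident with h joins two vertices consecutive on Q (i.e. is an edge of
-- the fan with path Q and handle h).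
InducedSubFan : {n : ℕ} → Graph n → List (Fin n) → Fin n → Set
InducedSubFan G X h =
  h ∈ X ×
  Σ (List _) λ Q →
    Unique Q × h ∉ Q × (∀ w → w ∈ X → w ≢ h → w ∈ Q) ×
    (∀ a b → a ∈ X → b ∈ X → Adj G a b → a ≢ h → b ≢ h → Consecutive Q a b)

FanWithOuterHandle : {n : ℕ} → Graph n → Fin n → Fin n
                     → List (Fin n) → List (Fin n) → Set
FanWithOuterHandle G u v I I₂ =
  ∃[ h ] (OuterInner h I₂ × InducedSubFan G (pathVerts u v I ++ pathVerts u v I₂) h)

-- Every terminal path of S is induced in G: a chord of the path P with inner vertices I either
-- joins u and v, and then S + uv contains K_{1,1,3}, or it shortens P to a uv-path missing an inner
-- vertex d of P, and then that path, the two other terminal paths and d form a K_1 ∪ K_{2,3}.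
-- Likewise no path from an inner vertex of P₁ to an inner vertex of P₃ can run through inner
-- vertices of P₂ while avoiding some inner vertex w of P₂: with the rest of P₁ ∪ P₃ it forms a
-- theta graph, and w is isolated from it.
-- Let b be an inner vertex of P₂ with a neighbour on P₁.  The second fact shows that b is an outer
-- inner vertex of P₂, say the one next to u, and that no edge joins an inner vertex of P₁ to another
-- inner vertex of P₂.  The first fact then shows that every edge of G[P₁ ∪ P₂] avoiding b joins
-- consecutive vertices of the path running along P₁ from u to v and back along P₂ towards b, so
-- G[P₁ ∪ P₂] lies in the fan with that path and handle b.  The case of b next to v and the pair
-- P₃, P₂ follow by symmetry.
module Submission where

open import Data.Empty using (⊥; ⊥-elim)
open import Data.Fin using (Fin)
open import Data.Fin.Patterns using (0F; 1F; 2F; 3F; 4F; 5F)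
open import Data.Fin.Properties using (_≟_)
open import Data.List using (List; []; _∷_; _++_; _∷ʳ_; reverse; [_]; map; concatMap; allFin)
open import Data.List.Membership.Propositional using (_∈_; _∉_)
open import Data.List.Membership.Propositional.Properties using (∈-∃++; ∈-++⁺ˡ; ∈-++⁺ʳ; ∈-++⁻; ∈-map⁺; ∈-map⁻; ∈-allFin)
open import Data.List.Properties using (unfold-reverse; reverse-++; reverse-injective; ++-assoc; ++-identityʳ; ∷-injective; map-++; map-∘; map-id)
open import Data.List.Relation.Binary.Subset.Propositional using (_⊆_)
open import Data.List.Relation.Binary.Subset.Propositional.Properties using () renaming (++⁺ to ⊆-++⁺)
open import Data.List.Relation.Unary.All using (All; []; _∷_)
open import Data.List.Relation.Unary.All.Properties using (¬Any⇒All¬; All¬⇒¬Any)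
open import Data.List.Relation.Unary.AllPairs using ([]; _∷_)
open import Data.List.Relation.Unary.Any using (here; there)
open import Data.List.Relation.Unary.Any.Properties using (reverse⁺)
open import Data.List.Relation.Unary.Linked as Linked using (Linked; []; [-]; _∷_)
open import Data.List.Relation.Unary.Unique.Propositional using (Unique)
open import Data.Maybe using (Maybe; just; nothing)
open import Data.Nat using (ℕ; _+_; _≤_; z≤n; s≤s)
open import Data.Nat.Properties using (+-assoc; +-comm; +-identityʳ; ≤-refl; ≤-trans; ≤-reflexive; +-monoʳ-≤; +-monoˡ-≤; m≤m+n; m≤n+m)
open import Data.Nat.Tactic.RingSolver using (solve-∀)
open import Data.Product using (∃-syntax; _×_; _,_; proj₁; proj₂)
open import Data.Sum using (_⊎_; inj₁; inj₂)
open import Function using (id)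
open import Relation.Binary.Definitions using (DecidableEquality; Symmetric)
open import Relation.Binary.PropositionalEquality using (_≡_; _≢_; refl; sym; trans; cong; cong₂; subst; subst₂; module ≡-Reasoning)
open import Relation.Nullary using (¬_; yes; no)

open import Defs renaming (sym to Adj-sym)

≤-via-common-summand : ∀ {l r s t} k → l ≡ s + k → r ≡ t + k → s ≤ t → l ≤ r
≤-via-common-summand k refl refl s≤t = +-monoˡ-≤ k s≤t

-- Multiplicities and sub-multisets

module Multiplicity {a} {A : Set a} (_≟_ : DecidableEquality A) where

  δ : A → A → ℕ
  δ z x with z ≟ x
  ... | yes _ = 1
  ... | no _  = 0

  count : A → List A → ℕ
  count z []       = 0
  count z (x ∷ xs) = δ z x + count z xs

  δ-refl : ∀ z → δ z z ≡ 1
  δ-refl z with z ≟ z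
  ... | yes _ = refl
  ... | no z≢z = ⊥-elim (z≢z refl)

  δ-≢ : ∀ {z x} → z ≢ x → δ z x ≡ 0
  δ-≢ {z} {x} z≢x with z ≟ x
  ... | yes z≡x = ⊥-elim (z≢x z≡x)
  ... | no _    = refl

  count-++ : ∀ z xs ys → count z (xs ++ ys) ≡ count z xs + count z ys
  count-++ z []       ys = refl
  count-++ z (x ∷ xs) ys = trans (cong (δ z x +_) (count-++ z xs ys)) (sym (+-assoc (δ z x) _ _))

  count-reverse : ∀ z xs → count z (reverse xs) ≡ count z xs
  count-reverse z []       = refl
  count-reverse z (x ∷ xs) = begin
    count z (reverse (x ∷ xs))            ≡⟨ cong (count z) (unfold-reverse x xs) ⟩
    count z (reverse xs ++ [ x ])         ≡⟨ count-++ z (reverse xs) [ x ] ⟩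
    count z (reverse xs) + (δ z x + 0)    ≡⟨ cong₂ _+_ (count-reverse z xs) (+-identityʳ (δ z x)) ⟩
    count z xs + δ z x                    ≡⟨ +-comm (count z xs) (δ z x) ⟩
    count z (x ∷ xs)                      ∎
    where open ≡-Reasoning

  ∈⇒1≤count : ∀ {z xs} → z ∈ xs → 1 ≤ count z xs
  ∈⇒1≤count {z} (here refl) = ≤-trans (≤-reflexive (sym (δ-refl z))) (m≤m+n _ _)
  ∈⇒1≤count {z} {x ∷ xs} (there z∈xs) = ≤-trans (∈⇒1≤count z∈xs) (m≤n+m (count z xs) (δ z x))

  1≤count⇒∈ : ∀ {z} xs → 1 ≤ count z xs → z ∈ xs
  1≤count⇒∈ {z} (x ∷ xs) 1≤c with z ≟ x
  ... | yes refl = here refl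
  ... | no _     = there (1≤count⇒∈ xs 1≤c)

  infix 4 _⊑_ _≋_

  record _⊑_ (xs ys : List A) : Set a where
    field count-≤ : ∀ z → count z xs ≤ count z ys
  open _⊑_ public

  record _≋_ (xs ys : List A) : Set a where
    field count-≡ : ∀ z → count z xs ≡ count z ys
  open _≋_ public

  ≋⇒⊑ : ∀ {xs ys} → xs ≋ ys → xs ⊑ ys
  ≋⇒⊑ xs≋ys .count-≤ z = ≤-reflexive (xs≋ys .count-≡ z)

  ≋-sym : ∀ {xs ys} → xs ≋ ys → ys ≋ xs
  ≋-sym xs≋ys .count-≡ z = sym (xs≋ys .count-≡ z)

  ⊑-refl : ∀ {xs} → xs ⊑ xs
  ⊑-refl .count-≤ z = ≤-refl

  ⊑-trans : ∀ {xs ys zs} → xs ⊑ ys → ys ⊑ zs → xs ⊑ zs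
  ⊑-trans xs⊑ys ys⊑zs .count-≤ z = ≤-trans (xs⊑ys .count-≤ z) (ys⊑zs .count-≤ z)

  ∷⁺-⊑ : ∀ {x xs ys} → xs ⊑ ys → x ∷ xs ⊑ x ∷ ys
  ∷⁺-⊑ {x} xs⊑ys .count-≤ z = +-monoʳ-≤ (δ z x) (xs⊑ys .count-≤ z)

  ⊑-∷ʳ : ∀ {xs ys} y → xs ⊑ ys → xs ⊑ y ∷ ys
  ⊑-∷ʳ y xs⊑ys .count-≤ z = ≤-trans (xs⊑ys .count-≤ z) (m≤n+m _ (δ z y))

  ⊑-reverseˡ : ∀ {xs ys} → xs ⊑ ys → reverse xs ⊑ ys
  ⊑-reverseˡ {xs} xs⊑ys .count-≤ z = subst (_≤ _) (sym (count-reverse z xs)) (xs⊑ys .count-≤ z)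

  ⊑-middle : ∀ {x ys zs} → x ∷ ys ⊑ zs → ∀ s e → x ∷ s ++ ys ++ e ⊑ s ++ zs ++ e
  ⊑-middle {x} {ys} {zs} x∷ys⊑zs s e .count-≤ z
    rewrite count-++ z s (ys ++ e) | count-++ z ys e | count-++ z s (zs ++ e) | count-++ z zs e =
    ≤-via-common-summand (count z s + count z e) (shuffle (δ z x) (count z s) (count z ys) (count z e))
      (shuffle′ (count z s) (count z zs) (count z e)) (x∷ys⊑zs .count-≤ z)
    where
    shuffle : ∀ d c-s c-ys c-e → d + (c-s + (c-ys + c-e)) ≡ (d + c-ys) + (c-s + c-e)
    shuffle = solve-∀
    shuffle′ : ∀ c-s c-zs c-e → c-s + (c-zs + c-e) ≡ c-zs + (c-s + c-e)
    shuffle′ = solve-∀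

  ⊑-++ʳ : ∀ xs {ys} → ys ⊑ xs ++ ys
  ⊑-++ʳ xs {ys} .count-≤ z = subst (count z ys ≤_) (sym (count-++ z xs ys)) (m≤n+m (count z ys) (count z xs))

  ∷-⊑-++-∷ : ∀ {x} xs {ys} → x ∷ xs ⊑ xs ++ x ∷ ys
  ∷-⊑-++-∷ {x} xs {ys} .count-≤ z = subst₂ _≤_ (+-comm (count z xs) (δ z x)) (sym (count-++ z xs (x ∷ ys)))
    (+-monoʳ-≤ (count z xs) (m≤m+n (δ z x) (count z ys)))

  ∈⇒[-]⊑ : ∀ {x xs} → x ∈ xs → [ x ] ⊑ xs
  ∈⇒[-]⊑ {x} x∈xs .count-≤ z with z ≟ x
  ... | yes refl = ∈⇒1≤count x∈xs
  ... | no _     = z≤n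

  ⊑⇒⊆ : ∀ {xs ys z} → xs ⊑ ys → z ∈ xs → z ∈ ys
  ⊑⇒⊆ {ys = ys} {z} xs⊑ys z∈xs = 1≤count⇒∈ ys (≤-trans (∈⇒1≤count z∈xs) (xs⊑ys .count-≤ z))

  Unique⇒count≤1 : ∀ {xs} → Unique xs → ∀ z → count z xs ≤ 1
  Unique⇒count≤1 []                    z = z≤n
  Unique⇒count≤1 {x ∷ xs} (x∉xs ∷ !xs) z with z ≟ x
  ... | no _     = Unique⇒count≤1 !xs z
  ... | yes refl = s≤s (≤-reflexive (count-∉ x∉xs))
    where
    count-∉ : ∀ {ys} → All (z ≢_) ys → count z ys ≡ 0
    count-∉ []           = refl
    count-∉ (z≢y ∷ z∉ys) = trans (cong (_+ _) (δ-≢ z≢y)) (count-∉ z∉ys)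

  count≤1⇒Unique : ∀ xs → (∀ z → count z xs ≤ 1) → Unique xs
  count≤1⇒Unique []       _      = []
  count≤1⇒Unique (x ∷ xs) count≤1 = ¬Any⇒All¬ xs x∉xs ∷ count≤1⇒Unique xs (λ z → ≤-trans (m≤n+m _ (δ z x)) (count≤1 z))
    where
    x∉xs : x ∉ xs
    x∉xs x∈xs with s≤s count≤0 ← subst (λ k → k + count x xs ≤ 1) (δ-refl x) (count≤1 x)
      with () ← ≤-trans (∈⇒1≤count x∈xs) count≤0

  Unique-⊑ : ∀ {xs ys} → Unique ys → xs ⊑ ys → Unique xs
  Unique-⊑ {xs} !ys xs⊑ys = count≤1⇒Unique xs (λ z → ≤-trans (xs⊑ys .count-≤ z) (Unique⇒count≤1 !ys z))

open module FinMultiplicity {n : ℕ} = Multiplicity (_≟_ {n})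

-- Lists, paths and consecutive vertices

module _ {a} {A : Set a} where

  split-∷ʳ : ∀ {xs : List A} {v} m {y q} → xs ∷ʳ v ≡ m ++ y ∷ q → ∃[ e ] (xs ≡ m ++ e × y ∷ q ≡ e ∷ʳ v)
  split-∷ʳ {xs} []                  eq = xs , refl , sym eq
  split-∷ʳ {[]}     (m₀ ∷ [])       ()
  split-∷ʳ {[]}     (m₀ ∷ m₁ ∷ m)   ()
  split-∷ʳ {x ∷ xs} (m₀ ∷ m)        eq with refl , eq′ ← ∷-injective eq with e , refl , y∷q≡ ← split-∷ʳ m eq′ =
    e , refl , y∷q≡

  ≢[]⇒∈ : ∀ {xs : List A} → xs ≢ [] → ∃[ x ] (x ∈ xs)
  ≢[]⇒∈ {[]}     xs≢[] = ⊥-elim (xs≢[] refl)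
  ≢[]⇒∈ {x ∷ _} _     = x , here refl

  reverse-≢[] : ∀ {xs : List A} → xs ≢ [] → reverse xs ≢ []
  reverse-≢[] xs≢[] eq = xs≢[] (reverse-injective eq)

  ++-∷-≢[] : ∀ (xs : List A) {y ys} → xs ++ y ∷ ys ≢ []
  ++-∷-≢[] []      ()
  ++-∷-≢[] (_ ∷ _) ()

  Precedes : List A → A → A → Set a
  Precedes F x y = ∃[ L ] ∃[ D ] ∃[ R ] (F ≡ L ++ x ∷ D ++ y ∷ R)

  precedes-or-follows : ∀ {F : List A} {x y} → x ∈ F → y ∈ F → x ≢ y → Precedes F x y ⊎ Precedes F y x
  precedes-or-follows (here refl)  (here refl)  x≢y = ⊥-elim (x≢y refl)
  precedes-or-follows (here refl)  (there y∈F)  _   with D , R , refl ← ∈-∃++ y∈F = inj₁ ([] , D , R , refl)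
  precedes-or-follows (there x∈F)  (here refl)  _   with D , R , refl ← ∈-∃++ x∈F = inj₂ ([] , D , R , refl)
  precedes-or-follows {f ∷ F} (there x∈F) (there y∈F) x≢y with precedes-or-follows x∈F y∈F x≢y
  ... | inj₁ (L , D , R , refl) = inj₁ (f ∷ L , D , R , refl)
  ... | inj₂ (L , D , R , refl) = inj₂ (f ∷ L , D , R , refl)

  reverse-∷-∷ : ∀ (x y : A) xs → reverse (x ∷ y ∷ xs) ≡ reverse xs ++ y ∷ x ∷ []
  reverse-∷-∷ x y xs = begin
    reverse (x ∷ y ∷ xs)           ≡⟨ unfold-reverse x (y ∷ xs) ⟩
    reverse (y ∷ xs) ++ [ x ]      ≡⟨ cong (_++ [ x ]) (unfold-reverse y xs) ⟩
    (reverse xs ++ [ y ]) ++ [ x ] ≡⟨ ++-assoc (reverse xs) [ y ] [ x ] ⟩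
    reverse xs ++ y ∷ x ∷ []       ∎
    where open ≡-Reasoning

  reverse-path-list : ∀ (x y : A) J → reverse (x ∷ J ++ [ y ]) ≡ y ∷ reverse J ++ [ x ]
  reverse-path-list x y J = begin
    reverse (x ∷ J ++ [ y ])       ≡⟨ unfold-reverse x (J ++ [ y ]) ⟩
    reverse (J ++ [ y ]) ++ [ x ]  ≡⟨ cong (_++ [ x ]) (reverse-++ J [ y ]) ⟩
    y ∷ reverse J ++ [ x ]         ∎
    where open ≡-Reasoning

  ∈-path-reverse : ∀ {w x y : A} J → w ∈ x ∷ J ++ [ y ] → w ∈ y ∷ reverse J ++ [ x ]
  ∈-path-reverse {w} {x} {y} J w∈ = subst (w ∈_) (reverse-path-list x y J) (reverse⁺ w∈)

  reverse-around : ∀ l (x y : A) r → reverse (l ++ x ∷ y ∷ r) ≡ reverse r ++ y ∷ x ∷ reverse l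
  reverse-around l x y r = begin
    reverse (l ++ x ∷ y ∷ r)               ≡⟨ reverse-++ l (x ∷ y ∷ r) ⟩
    reverse (x ∷ y ∷ r) ++ reverse l       ≡⟨ cong (_++ reverse l) (reverse-∷-∷ x y r) ⟩
    (reverse r ++ y ∷ x ∷ []) ++ reverse l ≡⟨ ++-assoc (reverse r) (y ∷ x ∷ []) (reverse l) ⟩
    reverse r ++ y ∷ x ∷ reverse l         ∎
    where open ≡-Reasoning

  split-around : ∀ {u v : A} {I} p {x} D {y} q → u ∷ I ++ [ v ] ≡ p ++ x ∷ D ++ y ∷ q →
                ∃[ s ] ∃[ e ] (I ≡ s ++ D ++ e × p ++ x ∷ y ∷ q ≡ u ∷ (s ++ e) ++ [ v ])
  split-around [] D q eq
    with refl , eq′ ← ∷-injective eq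
    with e , refl , y∷q≡e∷ʳv ← split-∷ʳ D eq′ = [] , e , refl , cong (_ ∷_) y∷q≡e∷ʳv
  split-around {v = v} (_ ∷ p) {x} D {y} q eq
    with refl , eq′ ← ∷-injective eq
    with e , refl , y∷q≡e∷ʳv ← split-∷ʳ (p ++ x ∷ D) (trans eq′ (sym (++-assoc p (x ∷ D) (y ∷ q)))) =
    p ++ [ x ] , e , trans (++-assoc p (x ∷ D) e) (sym (++-assoc p [ x ] (D ++ e))) , cong (_ ∷_) shortcut
    where
    shortcut : p ++ x ∷ y ∷ q ≡ ((p ++ [ x ]) ++ e) ++ [ v ]
    shortcut = begin
      p ++ x ∷ y ∷ q            ≡⟨ cong (λ t → p ++ x ∷ t) y∷q≡e∷ʳv ⟩
      p ++ x ∷ e ++ [ v ]       ≡⟨ sym (++-assoc p (x ∷ e) [ v ]) ⟩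
      (p ++ x ∷ e) ++ [ v ]     ≡⟨ cong (_++ [ v ]) (sym (++-assoc p [ x ] e)) ⟩
      ((p ++ [ x ]) ++ e) ++ [ v ] ∎
      where open ≡-Reasoning

module _ {a ℓ} {A : Set a} {R : A → A → Set ℓ} where

  Linked-++⁻ˡ : ∀ xs {ys} → Linked R (xs ++ ys) → Linked R xs
  Linked-++⁻ˡ []           _          = []
  Linked-++⁻ˡ (x ∷ [])     _          = [-]
  Linked-++⁻ˡ (x ∷ y ∷ xs) (r ∷ rxs) = r ∷ Linked-++⁻ˡ (y ∷ xs) rxs

  Linked-++⁻ʳ : ∀ xs {ys} → Linked R (xs ++ ys) → Linked R ys
  Linked-++⁻ʳ []       rys = rys
  Linked-++⁻ʳ (x ∷ xs) rys = Linked-++⁻ʳ xs (Linked.tail rys)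

  Linked-join : ∀ xs {x ys} → Linked R (xs ++ [ x ]) → Linked R (x ∷ ys) → Linked R (xs ++ x ∷ ys)
  Linked-join []           _         rys = rys
  Linked-join (_ ∷ [])     (r ∷ _)   rys = r ∷ rys
  Linked-join (_ ∷ y ∷ xs) (r ∷ rxs) rys = r ∷ Linked-join (y ∷ xs) rxs rys

  Linked-reverse : Symmetric R → ∀ {xs} → Linked R xs → Linked R (reverse xs)
  Linked-reverse sym-R {[]}         _         = []
  Linked-reverse sym-R {x ∷ []}     _         = [-]
  Linked-reverse sym-R {x ∷ y ∷ xs} (r ∷ rxs) =
    subst (Linked R) (sym (reverse-∷-∷ x y xs))
      (Linked-join (reverse xs) (subst (Linked R) (unfold-reverse y xs) (Linked-reverse sym-R rxs)) (sym-R r ∷ [-]))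

  Linked-shortcut : ∀ p {x} D {y q} → Linked R (p ++ x ∷ D ++ y ∷ q) → R x y → Linked R (p ++ x ∷ y ∷ q)
  Linked-shortcut p {x} D {y} {q} rs r =
    Linked-join p (Linked-++⁻ˡ (p ++ [ x ]) rs′) (r ∷ Linked-++⁻ʳ D (Linked-++⁻ʳ (p ++ [ x ]) rs′))
    where
    rs′ : Linked R ((p ++ [ x ]) ++ D ++ y ∷ q)
    rs′ = subst (Linked R) (sym (++-assoc p [ x ] (D ++ y ∷ q))) rs

  Linked-path-reverse : Symmetric R → ∀ {x y J} → Linked R (x ∷ J ++ [ y ]) → Linked R (y ∷ reverse J ++ [ x ])
  Linked-path-reverse sym-R {x} {y} {J} path = subst (Linked R) (reverse-path-list x y J) (Linked-reverse sym-R path)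

  Linked-path-++ : ∀ {x y z J K} → Linked R (x ∷ J ++ [ y ]) → Linked R (y ∷ K ++ [ z ]) → Linked R (x ∷ (J ++ y ∷ K) ++ [ z ])
  Linked-path-++ {x} {y} {z} {J} {K} path₁ path₂ =
    subst (Linked R) (cong (x ∷_) (sym (++-assoc J (y ∷ K) [ z ]))) (Linked-join (x ∷ J) path₁ path₂)

  Linked-path-prefix : ∀ {u v a} xs {ys} → Linked R (u ∷ (xs ++ a ∷ ys) ++ [ v ]) → Linked R (u ∷ xs ++ [ a ])
  Linked-path-prefix {u} {v} {a} xs {ys} path = Linked-++⁻ˡ (u ∷ xs ++ [ a ]) (subst (Linked R) split path)
    where
    split : u ∷ (xs ++ a ∷ ys) ++ [ v ] ≡ (u ∷ xs ++ [ a ]) ++ ys ++ [ v ]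
    split = cong (u ∷_) (trans (++-assoc xs (a ∷ ys) [ v ]) (sym (++-assoc xs [ a ] (ys ++ [ v ]))))

  Linked-path-suffix : ∀ {u v a} xs {ys} → Linked R (u ∷ (xs ++ a ∷ ys) ++ [ v ]) → Linked R (a ∷ ys ++ [ v ])
  Linked-path-suffix {u} {v} {a} xs {ys} path =
    Linked-++⁻ʳ (u ∷ xs) (subst (Linked R) (cong (u ∷_) (++-assoc xs (a ∷ ys) [ v ])) path)

module _ {n : ℕ} where

  Consecutive-++ʳ : ∀ {Q a b} (r : List (Fin n)) → Consecutive Q a b → Consecutive (Q ++ r) a b
  Consecutive-++ʳ {a = a} {b} r (l , r′ , inj₁ refl) = l , r′ ++ r , inj₁ (++-assoc l (a ∷ b ∷ r′) r)
  Consecutive-++ʳ {a = a} {b} r (l , r′ , inj₂ refl) = l , r′ ++ r , inj₂ (++-assoc l (b ∷ a ∷ r′) r)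

  Consecutive-++ˡ : ∀ {Q a b} (l : List (Fin n)) → Consecutive Q a b → Consecutive (l ++ Q) a b
  Consecutive-++ˡ {a = a} {b} l (l′ , r , inj₁ refl) = l ++ l′ , r , inj₁ (sym (++-assoc l l′ (a ∷ b ∷ r)))
  Consecutive-++ˡ {a = a} {b} l (l′ , r , inj₂ refl) = l ++ l′ , r , inj₂ (sym (++-assoc l l′ (b ∷ a ∷ r)))

  Consecutive-sym : ∀ {Q a b} → Consecutive {n} Q a b → Consecutive Q b a
  Consecutive-sym (l , r , inj₁ eq) = l , r , inj₂ eq
  Consecutive-sym (l , r , inj₂ eq) = l , r , inj₁ eq

  Consecutive-reverse : ∀ {Q a b} → Consecutive {n} Q a b → Consecutive (reverse Q) a b
  Consecutive-reverse {a = a} {b} (l , r , inj₁ refl) = reverse r , reverse l , inj₂ (reverse-around l a b r)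
  Consecutive-reverse {a = a} {b} (l , r , inj₂ refl) = reverse r , reverse l , inj₁ (reverse-around l b a r)

  lookupLabel : ∀ {L : Set} → Fin n → List (Fin n × L) → Maybe L
  lookupLabel w []             = nothing
  lookupLabel w ((x , k) ∷ ts) with w ≟ x
  ... | yes _ = just k
  ... | no _  = lookupLabel w ts

  lookupLabel-sound : ∀ {L : Set} {w k} (ts : List (Fin n × L)) → lookupLabel w ts ≡ just k → (w , k) ∈ ts
  lookupLabel-sound {w = w} ((x , _) ∷ ts) eq with w ≟ x | eq
  ... | yes refl | refl = here refl
  ... | no _     | eq′  = there (lookupLabel-sound ts eq′)

  lookupLabel-complete : ∀ {L : Set} {w k} (ts : List (Fin n × L)) → Unique (map proj₁ ts) →
                         (w , k) ∈ ts → lookupLabel w ts ≡ just k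
  lookupLabel-complete {w = w} ((x , _) ∷ ts) (x∉ts ∷ !ts) wk∈ with w ≟ x | wk∈
  ... | yes _    | here refl = refl
  ... | yes refl | there p   = ⊥-elim (All¬⇒¬Any x∉ts (∈-map⁺ proj₁ p))
  ... | no w≢x   | here refl = ⊥-elim (w≢x refl)
  ... | no _     | there p   = lookupLabel-complete ts !ts p

  module _ {m : ℕ} (B : Fin m → List (Fin n)) where

    labelled : List (Fin m) → List (Fin n × Fin m)
    labelled []       = []
    labelled (k ∷ ks) = map (_, k) (B k) ++ labelled ks

    unlabel-labelled : ∀ ks → map proj₁ (labelled ks) ≡ concatMap B ks
    unlabel-labelled []       = refl
    unlabel-labelled (k ∷ ks) = begin
      map proj₁ (map (_, k) (B k) ++ labelled ks)              ≡⟨ map-++ proj₁ (map (_, k) (B k)) (labelled ks) ⟩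
      map proj₁ (map (_, k) (B k)) ++ map proj₁ (labelled ks)  ≡⟨ cong₂ _++_ (sym (map-∘ (B k))) (unlabel-labelled ks) ⟩
      map id (B k) ++ concatMap B ks                           ≡⟨ cong (_++ _) (map-id (B k)) ⟩
      B k ++ concatMap B ks                                    ∎
      where open ≡-Reasoning

    ∈-labelled⁺ : ∀ {a k ks} → a ∈ B k → k ∈ ks → (a , k) ∈ labelled ks
    ∈-labelled⁺ a∈Bk (here refl)        = ∈-++⁺ˡ (∈-map⁺ (_, _) a∈Bk)
    ∈-labelled⁺ {ks = k′ ∷ _} a∈Bk (there k∈ks) = ∈-++⁺ʳ (map (_, k′) (B k′)) (∈-labelled⁺ a∈Bk k∈ks)

    ∈-labelled⁻ : ∀ {a k} ks → (a , k) ∈ labelled ks → a ∈ B k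
    ∈-labelled⁻ (k′ ∷ ks) ak∈ with ∈-++⁻ (map (_, k′) (B k′)) ak∈
    ... | inj₁ ak∈Bk′ with _ , a∈Bk′ , refl ← ∈-map⁻ (_, k′) ak∈Bk′ = a∈Bk′
    ... | inj₂ ak∈ks  = ∈-labelled⁻ ks ak∈ks

-- Chordless paths, minor models and theta graphs

module _ {n : ℕ} (G : Graph n) where

  Chordless : List (Fin n) → Set
  Chordless F = ∀ p {x} D {y} q → F ≡ p ++ x ∷ D ++ y ∷ q → D ≢ [] → ¬ Adj G x y

  Chordless-++⁻ʳ : ∀ l {F} → Chordless (l ++ F) → Chordless F
  Chordless-++⁻ʳ l chordless p {x} D {y} q refl = chordless (l ++ p) D q (sym (++-assoc l p (x ∷ D ++ y ∷ q)))

  Adj⇒≢ : ∀ {x y} → Adj G x y → x ≢ y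
  Adj⇒≢ xy refl = irrefl G xy

  Chordless⇒Consecutive : ∀ {F x y} → Chordless F → x ∈ F → y ∈ F → Adj G x y → Consecutive F x y
  Chordless⇒Consecutive chordless x∈F y∈F xy with precedes-or-follows x∈F y∈F (Adj⇒≢ xy)
  ... | inj₁ (L , []    , R , eq) = L , R , inj₁ eq
  ... | inj₁ (L , d ∷ D , R , eq) = ⊥-elim (chordless L (d ∷ D) R eq (λ ()) xy)
  ... | inj₂ (L , []    , R , eq) = L , R , inj₂ eq
  ... | inj₂ (L , d ∷ D , R , eq) = ⊥-elim (chordless L (d ∷ D) R eq (λ ()) (Adj-sym G xy))

  WalkIn-map : ∀ {P Q : Fin n → Set} {a b} → (∀ {z} → P z → Q z) → WalkIn G P a b → WalkIn G Q a b
  WalkIn-map f (here pa)        = here (f pa)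
  WalkIn-map f (step pa ab wlk) = step (f pa) ab (WalkIn-map f wlk)

  WalkIn-++ : ∀ {P a b c} → WalkIn G P a b → WalkIn G P b c → WalkIn G P a c
  WalkIn-++ (here _)         w = w
  WalkIn-++ (step pa ab wlk) w = step pa ab (WalkIn-++ wlk w)

  WalkIn-∷ʳ : ∀ {P a b c} → WalkIn G P a b → Adj G b c → P c → WalkIn G P a c
  WalkIn-∷ʳ wlk bc pc = WalkIn-++ wlk (step (WalkIn-last wlk) bc (here pc))
    where
    WalkIn-last : ∀ {P a b} → WalkIn G P a b → P b
    WalkIn-last (here pb)      = pb
    WalkIn-last (step _ _ wlk) = WalkIn-last wlk

  Linked⇒WalkIn : ∀ {L a b} → Linked (Adj G) L → a ∈ L → b ∈ L → WalkIn G (_∈ L) a b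
  Linked⇒WalkIn {x ∷ L} path a∈L b∈L = WalkIn-++ (to-head path a∈L) (from-head path b∈L)
    where
    to-head : ∀ {x L a} → Linked (Adj G) (x ∷ L) → a ∈ x ∷ L → WalkIn G (_∈ x ∷ L) a x
    to-head _              (here refl) = here (here refl)
    to-head {L = _ ∷ _} (xy ∷ path) (there a∈L) =
      WalkIn-∷ʳ (WalkIn-map there (to-head path a∈L)) (Adj-sym G xy) (here refl)

    from-head : ∀ {x L b} → Linked (Adj G) (x ∷ L) → b ∈ x ∷ L → WalkIn G (_∈ x ∷ L) x b
    from-head _              (here refl) = here (here refl)
    from-head {L = _ ∷ _} (xy ∷ path) (there b∈L) = step (here refl) xy (WalkIn-map there (from-head path b∈L))

  minorModel : ∀ {m} {H : Fin m → Fin m → Set} (B : Fin m → List (Fin n)) →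
               Unique (concatMap B (allFin m)) → (∀ k → B k ≢ []) → (∀ k → Linked (Adj G) (B k)) →
               (∀ k l → H k l → InnerLinked G (B k) (B l)) → MinorModel m H G
  minorModel {m} B unique nonempty connected edges = record
    { β         = β
    ; nonempty  = λ k → let a , a∈Bk = ≢[]⇒∈ (nonempty k) in a , β-complete a∈Bk
    ; connected = λ k a b βa βb → WalkIn-map β-complete (Linked⇒WalkIn (connected k) (β-sound βa) (β-sound βb))
    ; edges     = λ k l kl → let a , b , a∈Bk , b∈Bl , ab = edges k l kl in a , b , β-complete a∈Bk , β-complete b∈Bl , ab
    }
    where
    table : List (Fin n × Fin m)
    table = labelled B (allFin m)

    β : Fin n → Maybe (Fin m)
    β w = lookupLabel w table

    β-sound : ∀ {a k} → β a ≡ just k → a ∈ B k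
    β-sound βa = ∈-labelled⁻ B (allFin m) (lookupLabel-sound table βa)

    β-complete : ∀ {a k} → a ∈ B k → β a ≡ just k
    β-complete {k = k} a∈Bk = lookupLabel-complete table
      (subst Unique (sym (unlabel-labelled B (allFin m))) unique) (∈-labelled⁺ B a∈Bk (∈-allFin k))

  InnerLinked-sym : ∀ {X Y} → InnerLinked G X Y → InnerLinked G Y X
  InnerLinked-sym (a , b , a∈X , b∈Y , ab) = b , a , b∈Y , a∈X , Adj-sym G ab

  InnerLinked-mono : ∀ {X X′ Y Y′} → X ⊆ X′ → Y ⊆ Y′ → InnerLinked G X Y → InnerLinked G X′ Y′
  InnerLinked-mono X⊆X′ Y⊆Y′ (a , b , a∈X , b∈Y , ab) = a , b , X⊆X′ a∈X , Y⊆Y′ b∈Y , ab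

  InducedSubFan-⊆ : ∀ {X X′ h} → X ⊆ X′ → h ∈ X → InducedSubFan G X′ h → InducedSubFan G X h
  InducedSubFan-⊆ X⊆X′ h∈X (_ , Q , Q-unique , h∉Q , covered , edges) =
    h∈X , Q , Q-unique , h∉Q , (λ w w∈X → covered w (X⊆X′ w∈X)) , (λ x y x∈X y∈X → edges x y (X⊆X′ x∈X) (X⊆X′ y∈X))

  EdgeAdj-realised : ∀ {m} (es : List (Fin m × Fin m)) (B : Fin m → List (Fin n)) →
                     (∀ {k l} → (k , l) ∈ es → InnerLinked G (B k) (B l)) →
                     ∀ k l → EdgeAdj es k l → InnerLinked G (B k) (B l)
  EdgeAdj-realised es B realised k l (inj₁ kl∈es) = realised kl∈es
  EdgeAdj-realised es B realised k l (inj₂ lk∈es) = InnerLinked-sym (realised lk∈es)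

  inner-Linked : ∀ {x y J} → Linked (Adj G) (pathVerts x y J) → Linked (Adj G) J
  inner-Linked {J = J} path = Linked-++⁻ˡ J (Linked.tail path)

  first-edge : ∀ {x y J} → Linked (Adj G) (pathVerts x y J) → J ≢ [] → InnerLinked G [ x ] J
  first-edge {J = []}        _        J≢[] = ⊥-elim (J≢[] refl)
  first-edge {x} {J = j ∷ _} (xj ∷ _) _    = x , j , here refl , here refl , xj

  last-edge : ∀ {x y J} → Linked (Adj G) (pathVerts x y J) → J ≢ [] → InnerLinked G [ y ] J
  last-edge {J = []}          _             J≢[] = ⊥-elim (J≢[] refl)
  last-edge {y = y} {j ∷ []}  (_ ∷ jy ∷ _)  _    = y , j , here refl , here refl , Adj-sym G jy
  last-edge {J = _ ∷ _ ∷ _}   (_ ∷ path)    _    with a , b , a∈ , b∈ , ab ← last-edge path (λ ()) =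
    a , b , a∈ , there b∈ , ab

  -- Three x–y paths; that they are internally disjoint is a separate Unique hypothesis where needed.
  record Theta (x y : Fin n) (J₁ J₂ J₃ : List (Fin n)) : Set where
    field
      nonempty₁ : J₁ ≢ []
      nonempty₂ : J₂ ≢ []
      nonempty₃ : J₃ ≢ []
      path₁     : Linked (Adj G) (pathVerts x y J₁)
      path₂     : Linked (Adj G) (pathVerts x y J₂)
      path₃     : Linked (Adj G) (pathVerts x y J₃)

  module _ {x y J₁ J₂ J₃} (θ : Theta x y J₁ J₂ J₃) where
    open Theta θ

    Theta+isolated⇒K1∪K23 : ∀ {w} → Unique (w ∷ x ∷ y ∷ J₁ ++ J₂ ++ J₃) → HasMinor 6 K1∪K23 G
    Theta+isolated⇒K1∪K23 {w} unique = minorModel B unique′ nonempty connected (EdgeAdj-realised _ B realised)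
      where
      B : Fin 6 → List (Fin n)
      B 0F = [ w ]
      B 1F = [ x ]
      B 2F = [ y ]
      B 3F = J₁
      B 4F = J₂
      B 5F = J₃

      unique′ : Unique (concatMap B (allFin 6))
      unique′ = subst (λ J → Unique (w ∷ x ∷ y ∷ J₁ ++ J₂ ++ J)) (sym (++-identityʳ J₃)) unique

      nonempty : ∀ k → B k ≢ []
      nonempty 0F = λ ()
      nonempty 1F = λ ()
      nonempty 2F = λ ()
      nonempty 3F = nonempty₁
      nonempty 4F = nonempty₂
      nonempty 5F = nonempty₃

      connected : ∀ k → Linked (Adj G) (B k)
      connected 0F = [-]
      connected 1F = [-]
      connected 2F = [-]
      connected 3F = inner-Linked path₁
      connected 4F = inner-Linked path₂
      connected 5F = inner-Linked path₃

      realised : ∀ {k l} → (k , l) ∈ _ → InnerLinked G (B k) (B l)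
      realised (here refl)                                         = first-edge path₁ nonempty₁
      realised (there (here refl))                                 = first-edge path₂ nonempty₂
      realised (there (there (here refl)))                         = first-edge path₃ nonempty₃
      realised (there (there (there (here refl))))                 = last-edge path₁ nonempty₁
      realised (there (there (there (there (here refl)))))         = last-edge path₂ nonempty₂
      realised (there (there (there (there (there (here refl)))))) = last-edge path₃ nonempty₃

    Theta+edge⇒K113 : Unique (x ∷ y ∷ J₁ ++ J₂ ++ J₃) → Adj G x y → HasMinor 5 K113 G
    Theta+edge⇒K113 unique xy = minorModel B unique′ nonempty connected (EdgeAdj-realised _ B realised)
      where
      B : Fin 5 → List (Fin n)
      B 0F = [ x ]
      B 1F = [ y ]
      B 2F = J₁
      B 3F = J₂
      B 4F = J₃

      unique′ : Unique (concatMap B (allFin 5))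
      unique′ = subst (λ J → Unique (x ∷ y ∷ J₁ ++ J₂ ++ J)) (sym (++-identityʳ J₃)) unique

      nonempty : ∀ k → B k ≢ []
      nonempty 0F = λ ()
      nonempty 1F = λ ()
      nonempty 2F = nonempty₁
      nonempty 3F = nonempty₂
      nonempty 4F = nonempty₃

      connected : ∀ k → Linked (Adj G) (B k)
      connected 0F = [-]
      connected 1F = [-]
      connected 2F = inner-Linked path₁
      connected 3F = inner-Linked path₂
      connected 4F = inner-Linked path₃

      realised : ∀ {k l} → (k , l) ∈ _ → InnerLinked G (B k) (B l)
      realised (here refl)                                                 = x , y , here refl , here refl , xy
      realised (there (here refl))                                         = first-edge path₁ nonempty₁
      realised (there (there (here refl)))                                 = first-edge path₂ nonempty₂
      realised (there (there (there (here refl))))                         = first-edge path₃ nonempty₃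
      realised (there (there (there (there (here refl)))))                 = last-edge path₁ nonempty₁
      realised (there (there (there (there (there (here refl))))))         = last-edge path₂ nonempty₂
      realised (there (there (there (there (there (there (here refl))))))) = last-edge path₃ nonempty₃
  PathThrough : Fin n → Fin n → List (Fin n) → Set
  PathThrough a c T = ∃[ P ] (P ≢ [] × P ⊑ T × Linked (Adj G) (pathVerts a c P))

  bridge-from-head : ∀ {t T y a c} → Linked (Adj G) (t ∷ T) → y ∈ t ∷ T → Adj G a t → Adj G y c → PathThrough a c (t ∷ T)
  bridge-from-head _ (here refl) at yc = _ , (λ ()) , ∈⇒[-]⊑ (here refl) , at ∷ yc ∷ [-]
  bridge-from-head {T = _ ∷ _} (tt′ ∷ path) (there y∈T) at yc
    with P , _ , P⊑T , t-P-c ← bridge-from-head path y∈T tt′ yc = _ ∷ P , (λ ()) , ∷⁺-⊑ P⊑T , at ∷ t-P-c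

  bridge : ∀ {T x y a c} → Linked (Adj G) T → x ∈ T → y ∈ T → Adj G a x → Adj G y c → PathThrough a c T
  bridge path (here refl) y∈T ax yc = bridge-from-head path y∈T ax yc
  bridge path (there x∈T) (here refl) ax yc
    with P , P≢[] , P⊑T , c-P-a ← bridge-from-head path (there x∈T) (Adj-sym G yc) (Adj-sym G ax) =
    reverse P , reverse-≢[] P≢[] , ⊑-reverseˡ P⊑T , Linked-path-reverse (Adj-sym G) c-P-a
  bridge {t ∷ _} path (there x∈T) (there y∈T) ax yc
    with P , P≢[] , P⊑T , a-P-c ← bridge (Linked.tail path) x∈T y∈T ax yc = P , P≢[] , ⊑-∷ʳ t P⊑T , a-P-c

-- Symmetries of a spanning subdivision of K_{2,3}

module _ {n : ℕ} {G : Graph n} where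

  subdivision-theta : ∀ {u v I₁ I₂ I₃} → SpanningK23Subdivision G u v I₁ I₂ I₃ → Theta G u v I₁ I₂ I₃
  subdivision-theta S = record { SpanningK23Subdivision S }

  K23-count : ∀ z (u v : Fin n) I₁ I₂ I₃ → ℕ
  K23-count z u v I₁ I₂ I₃ = (δ z u + δ z v) + ((count z I₁ + count z I₂) + count z I₃)

  count-K23 : ∀ z (u v : Fin n) I₁ I₂ I₃ → count z (u ∷ v ∷ I₁ ++ I₂ ++ I₃) ≡ K23-count z u v I₁ I₂ I₃
  count-K23 z u v I₁ I₂ I₃ rewrite count-++ z I₁ (I₂ ++ I₃) | count-++ z I₂ I₃ =
    regroup (δ z u) (δ z v) (count z I₁) (count z I₂) (count z I₃)
    where
    regroup : ∀ a b c d e → a + (b + (c + (d + e))) ≡ (a + b) + ((c + d) + e)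
    regroup = solve-∀

  K23-reorder : ∀ {u v I₁ I₂ I₃ u′ v′ J₁ J₂ J₃} → SpanningK23Subdivision G u v I₁ I₂ I₃ →
                (∀ z → K23-count z u′ v′ J₁ J₂ J₃ ≡ K23-count z u v I₁ I₂ I₃) → Theta G u′ v′ J₁ J₂ J₃ →
                SpanningK23Subdivision G u′ v′ J₁ J₂ J₃
  K23-reorder {u} {v} {I₁} {I₂} {I₃} {u′} {v′} {J₁} {J₂} {J₃} S same-counts θ = record
    { Theta θ
    ; distinct = Unique-⊑ distinct (≋⇒⊑ same-vertices)
    ; spanning = λ w → ⊑⇒⊆ (≋⇒⊑ (≋-sym same-vertices)) (spanning w)
    }
    where
    open SpanningK23Subdivision S
    same-vertices : u′ ∷ v′ ∷ J₁ ++ J₂ ++ J₃ ≋ u ∷ v ∷ I₁ ++ I₂ ++ I₃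
    same-vertices .count-≡ z =
      trans (count-K23 z u′ v′ J₁ J₂ J₃) (trans (same-counts z) (sym (count-K23 z u v I₁ I₂ I₃)))

  swap₁₂ : ∀ {u v I₁ I₂ I₃} → SpanningK23Subdivision G u v I₁ I₂ I₃ → SpanningK23Subdivision G u v I₂ I₁ I₃
  swap₁₂ {u} {v} {I₁} {I₂} {I₃} S = K23-reorder S same-counts record
    { nonempty₁ = nonempty₂ ; nonempty₂ = nonempty₁ ; nonempty₃ = nonempty₃
    ; path₁ = path₂ ; path₂ = path₁ ; path₃ = path₃ }
    where
    open SpanningK23Subdivision S
    same-counts : ∀ z → K23-count z u v I₂ I₁ I₃ ≡ K23-count z u v I₁ I₂ I₃
    same-counts z = cong (λ k → (δ z u + δ z v) + (k + count z I₃)) (+-comm (count z I₂) (count z I₁))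

  swap₁₃ : ∀ {u v I₁ I₂ I₃} → SpanningK23Subdivision G u v I₁ I₂ I₃ → SpanningK23Subdivision G u v I₃ I₂ I₁
  swap₁₃ {u} {v} {I₁} {I₂} {I₃} S = K23-reorder S same-counts record
    { nonempty₁ = nonempty₃ ; nonempty₂ = nonempty₂ ; nonempty₃ = nonempty₁
    ; path₁ = path₃ ; path₂ = path₂ ; path₃ = path₁ }
    where
    open SpanningK23Subdivision S
    reverse-sum : ∀ a b c → (c + b) + a ≡ (a + b) + c
    reverse-sum = solve-∀
    same-counts : ∀ z → K23-count z u v I₃ I₂ I₁ ≡ K23-count z u v I₁ I₂ I₃
    same-counts z = cong (δ z u + δ z v +_) (reverse-sum (count z I₁) (count z I₂) (count z I₃))

  reverse-K23 : ∀ {u v I₁ I₂ I₃} → SpanningK23Subdivision G u v I₁ I₂ I₃ →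
                SpanningK23Subdivision G v u (reverse I₁) (reverse I₂) (reverse I₃)
  reverse-K23 {u} {v} {I₁} {I₂} {I₃} S = K23-reorder S same-counts record
    { nonempty₁ = reverse-≢[] nonempty₁ ; nonempty₂ = reverse-≢[] nonempty₂ ; nonempty₃ = reverse-≢[] nonempty₃
    ; path₁ = Linked-path-reverse (Adj-sym G) path₁
    ; path₂ = Linked-path-reverse (Adj-sym G) path₂
    ; path₃ = Linked-path-reverse (Adj-sym G) path₃ }
    where
    open SpanningK23Subdivision S
    same-counts : ∀ z → K23-count z v u (reverse I₁) (reverse I₂) (reverse I₃) ≡ K23-count z u v I₁ I₂ I₃
    same-counts z = cong₂ _+_ (+-comm (δ z v) (δ z u))
      (cong₂ _+_ (cong₂ _+_ (count-reverse z I₁) (count-reverse z I₂)) (count-reverse z I₃))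

-- Forbidden configurations

module _ {n : ℕ} {G : Graph n} (no-K113 : ¬ HasMinor 5 K113 G) (no-K1∪K23 : ¬ HasMinor 6 K1∪K23 G) where

  shortcut-forbidden : ∀ {u v I₁ I₂ I₃} → SpanningK23Subdivision G u v I₁ I₂ I₃ →
                       ∀ I′ {d} → Linked (Adj G) (pathVerts u v I′) → d ∷ I′ ⊑ I₁ → ⊥
  shortcut-forbidden S [] (uv ∷ _) _ = no-K113 (Theta+edge⇒K113 G (subdivision-theta S) distinct uv)
    where open SpanningK23Subdivision S
  shortcut-forbidden {u} {v} {I₁} {I₂} {I₃} S I′@(_ ∷ _) path′ d∷I′⊑I₁ =
    no-K1∪K23 (Theta+isolated⇒K1∪K23 G shortcut-theta
                 (Unique-⊑ distinct (⊑-middle d∷I′⊑I₁ (u ∷ v ∷ []) (I₂ ++ I₃))))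
    where
    open SpanningK23Subdivision S
    shortcut-theta : Theta G u v I′ I₂ I₃
    shortcut-theta = record
      { nonempty₁ = λ () ; nonempty₂ = nonempty₂ ; nonempty₃ = nonempty₃
      ; path₁ = path′ ; path₂ = path₂ ; path₃ = path₃ }

  path₁-chordless : ∀ {u v I₁ I₂ I₃} → SpanningK23Subdivision G u v I₁ I₂ I₃ → Chordless G (pathVerts u v I₁)
  path₁-chordless S p D q eq D≢[] xy
    with s , e , refl , shortcut≡ ← split-around p D q eq =
    shortcut-forbidden S (s ++ e)
      (subst (Linked (Adj G)) shortcut≡ (Linked-shortcut p D (subst (Linked (Adj G)) eq path₁) xy))
      (⊑-middle (∈⇒[-]⊑ (proj₂ (≢[]⇒∈ D≢[]))) s e)
    where open SpanningK23Subdivision S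

crossing-vertices : ∀ {n} {w a c u v : Fin n} A A′ C C′ P I₂ → w ∷ P ⊑ I₂ →
  w ∷ a ∷ c ∷ (reverse A ++ u ∷ C) ++ (A′ ++ v ∷ reverse C′) ++ P ⊑ u ∷ v ∷ (A ++ a ∷ A′) ++ I₂ ++ (C ++ c ∷ C′)
crossing-vertices {w = w} {a} {c} {u} {v} A A′ C C′ P I₂ w∷P⊑I₂ .count-≤ z =
  ≤-via-common-summand (δ z a + δ z c + δ z u + δ z v + count z A + count z A′ + count z C + count z C′)
    (trans count-left (regroup-left (δ z w) (δ z a) (δ z c) (count z A) (δ z u) (count z C)
                                    (count z A′) (δ z v) (count z C′) (count z P)))
    (trans count-right (regroup-right (δ z u) (δ z v) (count z A) (δ z a) (count z A′) (count z I₂)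
                                      (count z C) (δ z c) (count z C′)))
    (w∷P⊑I₂ .count-≤ z)
  where
  regroup-left : ∀ w a c A u C A′ v C′ P →
                 w + (a + (c + ((A + (u + C)) + ((A′ + (v + C′)) + P)))) ≡ (w + P) + (a + c + u + v + A + A′ + C + C′)
  regroup-left = solve-∀
  regroup-right : ∀ u v A a A′ I C c C′ →
                  u + (v + ((A + (a + A′)) + (I + (C + (c + C′))))) ≡ I + (a + c + u + v + A + A′ + C + C′)
  regroup-right = solve-∀
  count-left : count z (w ∷ a ∷ c ∷ (reverse A ++ u ∷ C) ++ (A′ ++ v ∷ reverse C′) ++ P) ≡
               δ z w + (δ z a + (δ z c + ((count z A + (δ z u + count z C))
                                          + ((count z A′ + (δ z v + count z C′)) + count z P))))
  count-left
    rewrite count-++ z (reverse A ++ u ∷ C) ((A′ ++ v ∷ reverse C′) ++ P) | count-++ z (A′ ++ v ∷ reverse C′) P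
          | count-++ z (reverse A) (u ∷ C) | count-++ z A′ (v ∷ reverse C′) | count-reverse z A | count-reverse z C′ = refl
  count-right : count z (u ∷ v ∷ (A ++ a ∷ A′) ++ I₂ ++ (C ++ c ∷ C′)) ≡
                δ z u + (δ z v + ((count z A + (δ z a + count z A′))
                                  + (count z I₂ + (count z C + (δ z c + count z C′)))))
  count-right
    rewrite count-++ z (A ++ a ∷ A′) (I₂ ++ (C ++ c ∷ C′)) | count-++ z A (a ∷ A′)
          | count-++ z I₂ (C ++ c ∷ C′) | count-++ z C (c ∷ C′) = refl

module _ {n : ℕ} {G : Graph n} (no-K1∪K23 : ¬ HasMinor 6 K1∪K23 G) where

  crossing-forbidden : ∀ {u v I₁ I₂ I₃ a c w T} → SpanningK23Subdivision G u v I₁ I₂ I₃ → a ∈ I₁ → c ∈ I₃ →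
                       PathThrough G a c T → w ∷ T ⊑ I₂ → ⊥
  crossing-forbidden {u} {v} {I₂ = I₂} {a = a} {c} {w} S a∈I₁ c∈I₃ (P , P≢[] , P⊑T , a-P-c) w∷T⊑I₂
    with A , A′ , refl ← ∈-∃++ a∈I₁ | C , C′ , refl ← ∈-∃++ c∈I₃ =
    no-K1∪K23 (Theta+isolated⇒K1∪K23 G θ (Unique-⊑ distinct (crossing-vertices A A′ C C′ P I₂ w∷P⊑I₂)))
    where
    open SpanningK23Subdivision S
    -- The three a–c paths run through u, through v, and along the given path.
    θ : Theta G a c (reverse A ++ u ∷ C) (A′ ++ v ∷ reverse C′) P
    θ = record
      { nonempty₁ = ++-∷-≢[] (reverse A) ; nonempty₂ = ++-∷-≢[] A′ ; nonempty₃ = P≢[]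
      ; path₁ = Linked-path-++ (Linked-path-reverse (Adj-sym G) (Linked-path-prefix A path₁)) (Linked-path-prefix C path₃)
      ; path₂ = Linked-path-++ (Linked-path-suffix A path₁) (Linked-path-reverse (Adj-sym G) (Linked-path-suffix C path₃))
      ; path₃ = a-P-c }

    w∷P⊑I₂ : w ∷ P ⊑ I₂
    w∷P⊑I₂ = ⊑-trans (∷⁺-⊑ P⊑T) w∷T⊑I₂

  -- The part of P₂ from b to b′ stays on one side of b and so avoids the neighbour of b on the
  -- other side.
  handle-not-interior : ∀ {u v I₁ l L b r R I₃ a} → SpanningK23Subdivision G u v I₁ (l ∷ L ++ b ∷ r ∷ R) I₃ →
                        a ∈ I₁ → Adj G a b → ¬ InnerLinked G (l ∷ L ++ b ∷ r ∷ R) I₃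
  handle-not-interior {l = l} {L} {b} {r} {R} S a∈I₁ ab (b′ , c′ , b′∈I₂ , c′∈I₃ , b′c′)
    with ∈-++⁻ (l ∷ L) b′∈I₂
  ... | inj₁ b′∈lL =
    crossing-forbidden S a∈I₁ c′∈I₃
      (bridge G (Linked.tail (Linked-path-prefix (l ∷ L) path₂)) (∈-++⁺ʳ (l ∷ L) (here refl)) (∈-++⁺ˡ b′∈lL) ab b′c′)
      (subst (r ∷ (l ∷ L ++ [ b ]) ⊑_) (++-assoc (l ∷ L) [ b ] (r ∷ R)) (∷-⊑-++-∷ (l ∷ L ++ [ b ])))
    where open SpanningK23Subdivision S
  ... | inj₂ b′∈bR =
    crossing-forbidden S a∈I₁ c′∈I₃
      (bridge G (Linked-++⁻ˡ (b ∷ r ∷ R) (Linked-path-suffix (l ∷ L) path₂)) (here refl) b′∈bR ab b′c′)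
      (∷⁺-⊑ (⊑-++ʳ L))
    where open SpanningK23Subdivision S

-- The fan

fan-vertices : ∀ {n} {b u v : Fin n} I₁ T I₃ → b ∷ (u ∷ I₁ ++ [ v ]) ++ reverse T ⊑ u ∷ v ∷ I₁ ++ (b ∷ T) ++ I₃
fan-vertices {b = b} {u} {v} I₁ T I₃ .count-≤ z =
  ≤-via-common-summand {s = 0} {t = count z I₃} (δ z b + δ z u + count z I₁ + δ z v + count z T)
    (trans count-left (regroup-left (δ z b) (δ z u) (count z I₁) (δ z v) (count z T)))
    (trans count-right (regroup-right (δ z b) (δ z u) (count z I₁) (δ z v) (count z T) (count z I₃)))
    z≤n
  where
  regroup-left : ∀ b u I₁ v T → b + ((u + (I₁ + (v + 0))) + T) ≡ 0 + (b + u + I₁ + v + T)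
  regroup-left = solve-∀
  regroup-right : ∀ b u I₁ v T I₃ → u + (v + (I₁ + ((b + T) + I₃))) ≡ I₃ + (b + u + I₁ + v + T)
  regroup-right = solve-∀
  count-left : count z (b ∷ (u ∷ I₁ ++ [ v ]) ++ reverse T) ≡ δ z b + ((δ z u + (count z I₁ + (δ z v + 0))) + count z T)
  count-left rewrite count-++ z (u ∷ I₁ ++ [ v ]) (reverse T) | count-++ z I₁ [ v ] | count-reverse z T = refl
  count-right : count z (u ∷ v ∷ I₁ ++ (b ∷ T) ++ I₃) ≡ δ z u + (δ z v + (count z I₁ + ((δ z b + count z T) + count z I₃)))
  count-right rewrite count-++ z I₁ ((b ∷ T) ++ I₃) | count-++ z T I₃ | sym (+-assoc (δ z b) (count z T) (count z I₃)) = refl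

-- The fan path runs along P₁ from u to v and then back along P₂ towards its handle b.
module HandleFirstFan {n : ℕ} {G : Graph n} (no-K113 : ¬ HasMinor 5 K113 G) (no-K1∪K23 : ¬ HasMinor 6 K1∪K23 G)
                      {u v I₁ b T I₃ a} (S : SpanningK23Subdivision G u v I₁ (b ∷ T) I₃)
                      (a∈I₁ : a ∈ I₁) (ab : Adj G a b) (P₂-meets-P₃ : InnerLinked G (b ∷ T) I₃) where

  open SpanningK23Subdivision S

  P₁ : List (Fin n)
  P₁ = pathVerts u v I₁

  X : List (Fin n)
  X = P₁ ++ pathVerts u v (b ∷ T)

  Q : List (Fin n)
  Q = P₁ ++ reverse T

  Q≡ : Q ≡ (u ∷ I₁) ++ reverse (T ++ [ v ])
  Q≡ = begin
    (u ∷ I₁ ++ [ v ]) ++ reverse T   ≡⟨ cong (u ∷_) (++-assoc I₁ [ v ] (reverse T)) ⟩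
    u ∷ I₁ ++ v ∷ reverse T          ≡⟨ cong (λ t → u ∷ I₁ ++ t) (sym (reverse-++ T [ v ])) ⟩
    (u ∷ I₁) ++ reverse (T ++ [ v ]) ∎
    where open ≡-Reasoning

  b∷Q-unique : Unique (b ∷ Q)
  b∷Q-unique = Unique-⊑ distinct (fan-vertices I₁ T I₃)

  P₁-chordless : Chordless G P₁
  P₁-chordless = path₁-chordless no-K113 no-K1∪K23 S

  P₂-chordless : Chordless G (pathVerts u v (b ∷ T))
  P₂-chordless = path₁-chordless no-K113 no-K1∪K23 (swap₁₂ S)

  T+v-chordless : Chordless G (T ++ [ v ])
  T+v-chordless = Chordless-++⁻ʳ G (u ∷ b ∷ []) P₂-chordless

  no-u-T-edge : ∀ {y} → y ∈ T → ¬ Adj G u y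
  no-u-T-edge y∈T with L , R , refl ← ∈-∃++ y∈T =
    P₂-chordless [] (b ∷ L) (R ++ [ v ]) (cong (λ t → u ∷ b ∷ t) (++-assoc L (_ ∷ R) [ v ])) (λ ())

  -- If b itself meets P₃ at c′, the path a b c′ avoids y; otherwise the edge xy and the part of P₂
  -- from y to the vertex b′ meeting P₃ give a path from P₁ to P₃ avoiding b.
  no-I₁-T-edge : ∀ {x y} → x ∈ I₁ → y ∈ T → ¬ Adj G x y
  no-I₁-T-edge = let _ , _ , b′∈P₂ , c′∈I₃ , b′c′ = P₂-meets-P₃ in avoiding b′∈P₂ c′∈I₃ b′c′
    where
    T-linked : Linked (Adj G) T
    T-linked = Linked-++⁻ˡ T (Linked.tail (Linked.tail path₂))

    avoiding : ∀ {b′ c′ x y} → b′ ∈ b ∷ T → c′ ∈ I₃ → Adj G b′ c′ → x ∈ I₁ → y ∈ T → ¬ Adj G x y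
    avoiding {y = y} (here refl) c′∈I₃ bc′ _ y∈T _ =
      crossing-forbidden no-K1∪K23 S a∈I₁ c′∈I₃ ([ b ] , (λ ()) , ⊑-refl , ab ∷ bc′ ∷ [-])
        (subst (y ∷ [ b ] ⊑_) (cong (b ∷_) (++-identityʳ T)) (⊑-middle (∈⇒[-]⊑ y∈T) [ b ] []))
    avoiding (there b′∈T) c′∈I₃ b′c′ x∈I₁ y∈T xy =
      crossing-forbidden no-K1∪K23 S x∈I₁ c′∈I₃ (bridge G T-linked y∈T b′∈T xy b′c′) ⊑-refl

  via-P₁ : ∀ {x y} → Consecutive P₁ x y → Consecutive Q x y
  via-P₁ = Consecutive-++ʳ (reverse T)

  via-T+v : ∀ {x y} → Consecutive (T ++ [ v ]) x y → Consecutive Q x y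
  via-T+v {x} {y} x~y = subst (λ Q → Consecutive Q x y) (sym Q≡) (Consecutive-++ˡ (u ∷ I₁) (Consecutive-reverse x~y))

  classify : ∀ {w} → w ∈ X → w ≢ b → w ∈ P₁ ⊎ w ∈ T ++ [ v ]
  classify w∈X w≢b with ∈-++⁻ P₁ w∈X
  ... | inj₁ w∈P₁                = inj₁ w∈P₁
  ... | inj₂ (here refl)         = inj₁ (here refl)
  ... | inj₂ (there (here refl)) = ⊥-elim (w≢b refl)
  ... | inj₂ (there (there w∈))  = inj₂ w∈

  covered : ∀ w → w ∈ X → w ≢ b → w ∈ Q
  covered w w∈X w≢b with classify w∈X w≢b
  ... | inj₁ w∈P₁  = ∈-++⁺ˡ w∈P₁
  ... | inj₂ w∈T+v = subst (w ∈_) (sym Q≡) (∈-++⁺ʳ (u ∷ I₁) (reverse⁺ w∈T+v))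

  P₁-to-T+v-edge : ∀ {x y} → x ∈ P₁ → y ∈ T ++ [ v ] → Adj G x y → Consecutive Q x y
  P₁-to-T+v-edge x∈P₁ y∈T+v xy with ∈-++⁻ T y∈T+v
  ... | inj₂ (here refl) = via-P₁ (Chordless⇒Consecutive G P₁-chordless x∈P₁ (there (∈-++⁺ʳ I₁ (here refl))) xy)
  ... | inj₁ y∈T with x∈P₁
  ...   | here refl = ⊥-elim (no-u-T-edge y∈T xy)
  ...   | there x∈I₁+v with ∈-++⁻ I₁ x∈I₁+v
  ...     | inj₁ x∈I₁       = ⊥-elim (no-I₁-T-edge x∈I₁ y∈T xy)
  ...     | inj₂ (here refl) = via-T+v (Chordless⇒Consecutive G T+v-chordless (∈-++⁺ʳ T (here refl)) y∈T+v xy)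

  fan-edges : ∀ x y → x ∈ X → y ∈ X → Adj G x y → x ≢ b → y ≢ b → Consecutive Q x y
  fan-edges x y x∈X y∈X xy x≢b y≢b with classify x∈X x≢b | classify y∈X y≢b
  ... | inj₁ x∈P₁  | inj₁ y∈P₁  = via-P₁ (Chordless⇒Consecutive G P₁-chordless x∈P₁ y∈P₁ xy)
  ... | inj₂ x∈T+v | inj₂ y∈T+v = via-T+v (Chordless⇒Consecutive G T+v-chordless x∈T+v y∈T+v xy)
  ... | inj₁ x∈P₁  | inj₂ y∈T+v = P₁-to-T+v-edge x∈P₁ y∈T+v xy
  ... | inj₂ x∈T+v | inj₁ y∈P₁  = Consecutive-sym (P₁-to-T+v-edge y∈P₁ x∈T+v (Adj-sym G xy))

  fan : InducedSubFan G X b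
  fan with b∉Q ∷ Q-unique ← b∷Q-unique =
    ∈-++⁺ʳ P₁ (there (here refl)) , Q , Q-unique , All¬⇒¬Any b∉Q , covered , fan-edges

module _ {n : ℕ} {G : Graph n} (no-K113 : ¬ HasMinor 5 K113 G) (no-K1∪K23 : ¬ HasMinor 6 K1∪K23 G) where

  handle-first-fan : ∀ {u v I₁ I₂ I₃ b T a} → SpanningK23Subdivision G u v I₁ I₂ I₃ → I₂ ≡ b ∷ T →
                     a ∈ I₁ → Adj G a b → InnerLinked G I₂ I₃ →
                     InducedSubFan G (pathVerts u v I₁ ++ pathVerts u v I₂) b
  handle-first-fan S refl a∈I₁ ab P₂-meets-P₃ = HandleFirstFan.fan no-K113 no-K1∪K23 S a∈I₁ ab P₂-meets-P₃

  handle-last-fan : ∀ {u v I₁ I₂ I₃ L b a} → SpanningK23Subdivision G u v I₁ I₂ I₃ → I₂ ≡ L ++ [ b ] →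
                    a ∈ I₁ → Adj G a b → InnerLinked G I₂ I₃ →
                    InducedSubFan G (pathVerts u v I₁ ++ pathVerts u v I₂) b
  handle-last-fan {u} {v} {I₁} {L = L} {b} S refl a∈I₁ ab P₂-meets-P₃ =
    InducedSubFan-⊆ G (⊆-++⁺ (∈-path-reverse I₁) (∈-path-reverse (L ++ [ b ])))
      (∈-++⁺ʳ (pathVerts u v I₁) (there (∈-++⁺ˡ (∈-++⁺ʳ L (here refl)))))
      (handle-first-fan (reverse-K23 S) (reverse-++ L [ b ]) (reverse⁺ a∈I₁) ab (InnerLinked-mono G reverse⁺ reverse⁺ P₂-meets-P₃))

  fan-with-outer-handle : ∀ {u v I₁ I₂ I₃} → SpanningK23Subdivision G u v I₁ I₂ I₃ → MiddlePath G I₁ I₂ I₃ →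
                          FanWithOuterHandle G u v I₁ I₂
  fan-with-outer-handle S ((b , a , b∈I₂ , a∈I₁ , ba) , P₂-meets-P₃) with ∈-∃++ b∈I₂
  ... | []    , T     , I₂≡ = b , inj₁ (T , I₂≡) , handle-first-fan S I₂≡ a∈I₁ (Adj-sym G ba) P₂-meets-P₃
  ... | L     , []    , I₂≡ = b , inj₂ (L , I₂≡) , handle-last-fan S I₂≡ a∈I₁ (Adj-sym G ba) P₂-meets-P₃
  ... | _ ∷ _ , _ ∷ _ , refl = ⊥-elim (handle-not-interior no-K1∪K23 S a∈I₁ (Adj-sym G ba) P₂-meets-P₃)

lemma8 : {n : ℕ} (G : Graph n) →
         ¬ HasMinor 5 K113 G → ¬ HasMinor 5 K1∪K4 G → ¬ HasMinor 6 K1∪K23 G →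
         (u v : Fin n) (I₁ I₂ I₃ : List (Fin n)) →
         SpanningK23Subdivision G u v I₁ I₂ I₃ →
         MiddlePath G I₁ I₂ I₃ →
         FanWithOuterHandle G u v I₁ I₂ × FanWithOuterHandle G u v I₃ I₂
lemma8 G no-K113 _ no-K1∪K23 u v I₁ I₂ I₃ S (P₂-meets-P₁ , P₂-meets-P₃) =
  fan-with-outer-handle no-K113 no-K1∪K23 S (P₂-meets-P₁ , P₂-meets-P₃) ,
  fan-with-outer-handle no-K113 no-K1∪K23 (swap₁₃ S) (P₂-meets-P₃ , P₂-meets-P₁)
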